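{- Let $\mathcal F$ be the set of integers $b\ge 1$ such that the closed interval $[4\cdot 5^{b-1},5^b]$ contains no number of the form $2^k$ with $k\ge 0$ an integer. Then, as $x\to\infty$, $$\#\{b\in\mathcal F: b\le x\}\sim \beta x,\qquad \beta=3-\frac{\log 5}{\log 2}=0.678\ldots.$$ -}

module Defs where

open import Data.Nat using (ℕ; suc; _+_; _*_; _∸_; _^_; _≤_; _<_)
open import Data.Product using (_×_)
open import Data.List using (List; length; filter; upTo)
open import Relation.Nullary using (¬_)
open import Relation.Unary using (Pred; Decidable)
open import Level using (0ℓ)

InF : Pred ℕ 0ℓ
InF b = (1 ≤ b) × (∀ (k : ℕ) → ¬ ((4 * 5 ^ (b ∸ 1) ≤ 2 ^ k) × (2 ^ k ≤ 5 ^ b)))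

-- #{ b ∈ 𝓕 : b ≤ x }, computed using any decision procedure for InF
-- (the value does not depend on which one is used).
countF : Decidable InF → ℕ → List ℕ
countF dec x = filter dec (upTo (suc x))

#F : Decidable InF → ℕ → ℕ
#F dec x = length (countF dec x)

-- "| c/x - β | < 1/m"  with  β = 3 - log 5 / log 2 = 3 - log₂ 5,
-- written with integer arithmetic (x ≥ 1, m ≥ 1):
--   c/x < β + 1/m  ⟺  log₂5 < (3xm + x - cm)/(xm)  ⟺  5^(xm) < 2^(3xm + x - cm)
--   c/x > β - 1/m  ⟺  log₂5 > (3xm - x - cm)/(xm)  ⟺  2^(3xm - x - cm) < 5^(xm)
-- (truncated subtraction is harmless: a non-positive exponent makes the
--  first condition false and the second one true, as it should be).
CloseToβ : ℕ → ℕ → ℕ → Set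
CloseToβ m x c =
  (2 ^ ((3 * x * m) ∸ (x + c * m)) < 5 ^ (x * m)) ×
  (5 ^ (x * m) < 2 ^ ((3 * x * m + x) ∸ (c * m)))

module Submission where

-- Multiplying 5^b by 5 raises ⌊log₂ 5^b⌋ by 2 or 3, and the interval [4·5^b, 5·5^b]
-- contains a power of two exactly when it rises by 3. Summing over b gives the exact
-- formula #F(x) + ⌊x log₂ 5⌋ + 1 = 3x, so #F(x)/x differs from 3 - log₂ 5 by less
-- than 1/x.

open import Defs
open import Data.Nat using (ℕ; zero; suc; _+_; _*_; _∸_; _^_; _≤_; _<_; _%_; z≤n; s≤s; NonZero)
open import Data.Nat.Properties
open import Data.Nat.DivMod using (%-distribˡ-*; m*n%n≡0)
open import Data.Nat.Tactic.RingSolver using (solve-∀)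
open import Data.Product using (∃-syntax; _×_; _,_)
open import Data.Sum using (_⊎_; inj₁; inj₂)
open import Data.List using ([]; _∷_; _++_; length; filter; upTo)
import Data.List.Properties as List
open import Data.Empty using (⊥-elim)
open import Relation.Nullary using (¬_; yes; no)
open import Relation.Unary using (Decidable)
open import Relation.Binary using (tri<; tri≈; tri>)
open import Relation.Binary.PropositionalEquality

module _ (dec : Decidable InF) where

  countF-suc : ∀ x → countF dec (suc x) ≡ countF dec x ++ filter dec (suc x ∷ [])
  countF-suc x = trans (cong (filter dec) (sym (List.upTo-∷ʳ (suc x))))
                       (List.filter-++ dec (upTo (suc x)) (suc x ∷ []))

  #F-suc : ∀ x → #F dec (suc x) ≡ #F dec x + length (filter dec (suc x ∷ []))
  #F-suc x = trans (cong length (countF-suc x)) (List.length-++ (countF dec x))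

  #F-suc-accept : ∀ x → InF (suc x) → #F dec (suc x) ≡ suc (#F dec x)
  #F-suc-accept x p = begin
    #F dec (suc x)                               ≡⟨ #F-suc x ⟩
    #F dec x + length (filter dec (suc x ∷ []))  ≡⟨ cong (λ l → #F dec x + length l) (List.filter-accept dec {xs = []} p) ⟩
    #F dec x + 1                                 ≡⟨ +-comm (#F dec x) 1 ⟩
    suc (#F dec x)                               ∎
    where open ≡-Reasoning

  #F-suc-reject : ∀ x → ¬ InF (suc x) → #F dec (suc x) ≡ #F dec x
  #F-suc-reject x p = begin
    #F dec (suc x)                               ≡⟨ #F-suc x ⟩
    #F dec x + length (filter dec (suc x ∷ []))  ≡⟨ cong (λ l → #F dec x + length l) (List.filter-reject dec {xs = []} p) ⟩
    #F dec x + 0                                 ≡⟨ +-identityʳ (#F dec x) ⟩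
    #F dec x                                     ∎
    where open ≡-Reasoning

  #F-zero : #F dec 0 ≡ 0
  #F-zero = cong length (List.filter-reject dec {xs = []} λ { (() , _) })

5^n%2≡1 : ∀ n → 5 ^ n % 2 ≡ 1
5^n%2≡1 zero    = refl
5^n%2≡1 (suc n) = trans (%-distribˡ-* 5 (5 ^ n) 2) (cong (λ r → (5 % 2 * r) % 2) (5^n%2≡1 n))

2^[1+m]≢5^n : ∀ m n → 2 ^ suc m ≢ 5 ^ n
2^[1+m]≢5^n m n eq = 0≢1+n (begin
  0                ≡⟨ m*n%n≡0 (2 ^ m) 2 ⟨
  2 ^ m * 2 % 2    ≡⟨ cong (_% 2) (*-comm (2 ^ m) 2) ⟩
  2 ^ suc m % 2    ≡⟨ cong (_% 2) eq ⟩
  5 ^ n % 2        ≡⟨ 5^n%2≡1 n ⟩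
  1                ∎)
  where open ≡-Reasoning

2^[2+n]≡4*2^n : ∀ n → 2 ^ (2 + n) ≡ 4 * 2 ^ n
2^[2+n]≡4*2^n n = sym (*-assoc 2 2 (2 ^ n))

2^[3+n]≡8*2^n : ∀ n → 2 ^ (3 + n) ≡ 8 * 2 ^ n
2^[3+n]≡8*2^n n = trans (sym (*-assoc 2 2 (2 * 2 ^ n))) (sym (*-assoc 4 2 (2 ^ n)))

record BetweenPowersOf2 (L y : ℕ) : Set where
  constructor between
  field
    lower : 2 ^ L < y
    upper : y < 2 ^ suc L

module _ {L y : ℕ} (bracket : BetweenPowersOf2 L y) where
  open ≤-Reasoning
  open BetweenPowersOf2 bracket renaming (lower to 2^L<y; upper to y<2^[1+L])

  no-power-of-2-in-[4y,5y] : 5 * y < 2 ^ (3 + L) → ∀ k → ¬ (4 * y ≤ 2 ^ k × 2 ^ k ≤ 5 * y)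
  no-power-of-2-in-[4y,5y] 5y<2^[3+L] k (4y≤2^k , 2^k≤5y) with k ≤? 2 + L
  ... | yes k≤2+L = <-irrefl refl (begin-strict
    2 ^ k        ≤⟨ ^-monoʳ-≤ 2 k≤2+L ⟩
    2 ^ (2 + L)  ≡⟨ 2^[2+n]≡4*2^n L ⟩
    4 * 2 ^ L    <⟨ *-monoʳ-< 4 2^L<y ⟩
    4 * y        ≤⟨ 4y≤2^k ⟩
    2 ^ k        ∎)
  ... | no k≰2+L = <-irrefl refl (begin-strict
    2 ^ (3 + L)  ≤⟨ ^-monoʳ-≤ 2 (≰⇒> k≰2+L) ⟩
    2 ^ k        ≤⟨ 2^k≤5y ⟩
    5 * y        <⟨ 5y<2^[3+L] ⟩
    2 ^ (3 + L)  ∎)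

  4y≤2^[3+L] : 4 * y ≤ 2 ^ (3 + L)
  4y≤2^[3+L] = begin
    4 * y          ≤⟨ *-monoʳ-≤ 4 (<⇒≤ y<2^[1+L]) ⟩
    4 * 2 ^ suc L  ≡⟨ 2^[2+n]≡4*2^n (suc L) ⟨
    2 ^ (3 + L)    ∎

  5y-below : 5 * y < 2 ^ (3 + L) → BetweenPowersOf2 (2 + L) (5 * y)
  5y-below 5y<2^[3+L] = between lower 5y<2^[3+L]
    where
    lower : 2 ^ (2 + L) < 5 * y
    lower = begin-strict
      2 ^ (2 + L)  ≡⟨ 2^[2+n]≡4*2^n L ⟩
      4 * 2 ^ L    <⟨ *-monoʳ-< 4 2^L<y ⟩
      4 * y        ≤⟨ *-monoˡ-≤ y (n≤1+n 4) ⟩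
      5 * y        ∎

  5y-above : 2 ^ (3 + L) < 5 * y → BetweenPowersOf2 (3 + L) (5 * y)
  5y-above 2^[3+L]<5y = between 2^[3+L]<5y upper
    where
    upper : 5 * y < 2 ^ (4 + L)
    upper = begin-strict
      5 * y          <⟨ *-monoʳ-< 5 y<2^[1+L] ⟩
      5 * 2 ^ suc L  ≤⟨ *-monoˡ-≤ (2 ^ suc L) (m≤m+n 5 3) ⟩
      8 * 2 ^ suc L  ≡⟨ 2^[3+n]≡8*2^n (suc L) ⟨
      2 ^ (4 + L)    ∎

InF-suc-step : ∀ b {L} → BetweenPowersOf2 L (5 ^ b) →
  (InF (suc b) × BetweenPowersOf2 (2 + L) (5 ^ suc b)) ⊎
  (¬ InF (suc b) × BetweenPowersOf2 (3 + L) (5 ^ suc b))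
InF-suc-step b {L} bracket with <-cmp (5 ^ suc b) (2 ^ (3 + L))
... | tri< below _ _ = inj₁ ((s≤s z≤n , no-power-of-2-in-[4y,5y] bracket below) , 5y-below bracket below)
... | tri≈ _ eq _    = ⊥-elim (2^[1+m]≢5^n (2 + L) (suc b) (sym eq))
... | tri> _ _ above = inj₂ ((λ (_ , noPower) → noPower (3 + L) (4y≤2^[3+L] bracket , <⇒≤ above)) ,
                             5y-above bracket above)

#F-closed-form : (dec : Decidable InF) → ∀ n →
  ∃[ L ] (BetweenPowersOf2 L (5 ^ suc n) × #F dec (suc n) + suc L ≡ 3 * suc n)
#F-closed-form dec zero = 2 , between (s≤s (s≤s (s≤s (s≤s (s≤s z≤n))))) (s≤s (s≤s (s≤s (s≤s (s≤s (s≤s z≤n)))))) ,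
  cong (_+ 3) (trans (#F-suc-reject dec 0 1∉F) (#F-zero dec))
  where
  1∉F : ¬ InF 1
  1∉F (_ , noPower) = noPower 2 (≤-refl , s≤s (s≤s (s≤s (s≤s z≤n))))
#F-closed-form dec (suc n) with #F-closed-form dec n
... | L , bracket , count with InF-suc-step (suc n) bracket
... | inj₁ (accept , bracket′) = 2 + L , bracket′ , (begin
  #F dec (2 + n) + suc (2 + L)    ≡⟨ cong (_+ suc (2 + L)) (#F-suc-accept dec (suc n) accept) ⟩
  suc (#F dec (suc n)) + (3 + L)  ≡⟨ shift (#F dec (suc n)) L ⟩
  3 + (#F dec (suc n) + suc L)    ≡⟨ cong (3 +_) count ⟩
  3 + 3 * suc n                   ≡⟨ *-suc 3 (suc n) ⟨
  3 * (2 + n)                     ∎)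
  where
  open ≡-Reasoning
  shift : ∀ c L → suc c + (3 + L) ≡ 3 + (c + suc L)
  shift = solve-∀
... | inj₂ (reject , bracket′) = 3 + L , bracket′ , (begin
  #F dec (2 + n) + suc (3 + L)    ≡⟨ cong (_+ suc (3 + L)) (#F-suc-reject dec (suc n) reject) ⟩
  #F dec (suc n) + (4 + L)        ≡⟨ shift (#F dec (suc n)) L ⟩
  3 + (#F dec (suc n) + suc L)    ≡⟨ cong (3 +_) count ⟩
  3 + 3 * suc n                   ≡⟨ *-suc 3 (suc n) ⟨
  3 * (2 + n)                     ∎)
  where
  open ≡-Reasoning
  shift : ∀ c L → c + (4 + L) ≡ 3 + (c + suc L)
  shift = solve-∀

closeToβ : ∀ M .{{_ : NonZero M}} {x c L} → M ≤ x → BetweenPowersOf2 L (5 ^ x) → c + suc L ≡ 3 * x →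
           CloseToβ M x c
closeToβ M {x} {c} {L} M≤x (between 2^L<5^x 5^x<2^[1+L]) count = lowerBound , upperBound
  where
  open ≤-Reasoning

  3xM≡cM+[1+L]M : 3 * x * M ≡ c * M + suc L * M
  3xM≡cM+[1+L]M = trans (cong (_* M) (sym count)) (*-distribʳ-+ M c (suc L))

  lowerExponent : 3 * x * M ∸ (x + c * M) ≤ L * M
  lowerExponent = m≤n+o⇒m∸n≤o (3 * x * M) (x + c * M) (begin
    3 * x * M              ≡⟨ 3xM≡cM+[1+L]M ⟩
    c * M + (M + L * M)    ≡⟨ regroup (c * M) M (L * M) ⟩
    (M + c * M) + L * M    ≤⟨ +-monoˡ-≤ (L * M) (+-monoˡ-≤ (c * M) M≤x) ⟩
    (x + c * M) + L * M    ∎)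
    where
    regroup : ∀ a b d → a + (b + d) ≡ (b + a) + d
    regroup = solve-∀

  upperExponent : suc L * M ≤ (3 * x * M + x) ∸ c * M
  upperExponent = m+n≤o⇒m≤o∸n (suc L * M) (begin
    suc L * M + c * M  ≡⟨ +-comm (suc L * M) (c * M) ⟩
    c * M + suc L * M  ≡⟨ 3xM≡cM+[1+L]M ⟨
    3 * x * M          ≤⟨ m≤m+n (3 * x * M) x ⟩
    3 * x * M + x      ∎)

  lowerBound : 2 ^ (3 * x * M ∸ (x + c * M)) < 5 ^ (x * M)
  lowerBound = begin-strict
    2 ^ (3 * x * M ∸ (x + c * M))  ≤⟨ ^-monoʳ-≤ 2 lowerExponent ⟩
    2 ^ (L * M)                    ≡⟨ ^-*-assoc 2 L M ⟨
    (2 ^ L) ^ M                    <⟨ ^-monoˡ-< M 2^L<5^x ⟩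
    (5 ^ x) ^ M                    ≡⟨ ^-*-assoc 5 x M ⟩
    5 ^ (x * M)                    ∎

  upperBound : 5 ^ (x * M) < 2 ^ ((3 * x * M + x) ∸ c * M)
  upperBound = begin-strict
    5 ^ (x * M)                      ≡⟨ ^-*-assoc 5 x M ⟨
    (5 ^ x) ^ M                      <⟨ ^-monoˡ-< M 5^x<2^[1+L] ⟩
    (2 ^ suc L) ^ M                  ≡⟨ ^-*-assoc 2 (suc L) M ⟩
    2 ^ (suc L * M)                  ≤⟨ ^-monoʳ-≤ 2 upperExponent ⟩
    2 ^ ((3 * x * M + x) ∸ c * M)    ∎

proposition1 : (dec : Decidable InF) → ∀ (m : ℕ) → ∃[ N ] (∀ (x : ℕ) → N ≤ x → 1 ≤ x → CloseToβ (suc m) x (#F dec x))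
proposition1 dec m = suc m , close
  where
  close : ∀ x → suc m ≤ x → 1 ≤ x → CloseToβ (suc m) x (#F dec x)
  close (suc n) m<x _ with #F-closed-form dec n
  ... | L , bracket , count = closeToβ (suc m) m<x bracket count
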